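{- Let $k\ge2$, $a_1,\dots,a_k\in\mathbb{Z}$ and $h_1,\dots,h_{k-1}\in\mathbb{Z}$. Let $(f_n)_{n\ge0}$ be defined by $f_0=1$, $f_i=h_i$ for $1\le i<k$, and $f_n=a_1f_{n-1}+\dots+a_kf_{n-k}$ for $n\ge k$. Consider the extended succession rule with label types $B$ (value $h_1$) and $A$ (value $a_1$), root $B$, and productions $$(h_1)\stackrel{1}{\rightsquigarrow}(a_1)^{h_1},\qquad (h_1)\stackrel{i}{\rightsquigarrow}(a_1)^{h_i-\sum_{j=1}^{i-1}h_ja_{i-j}}\ (1<i<k),\qquad (h_1)\stackrel{k}{\rightsquigarrow}(a_1)^{a_k},$$ $$(a_1)\stackrel{j}{\rightsquigarrow}(a_1)^{a_j}\quad(1\le j\le k),$$ i.e. a node of type $B$ has $h_1$ (signed) children of type $A$ at jump $1$, $h_i-\sum_{j=1}^{i-1}h_ja_{i-j}$ (signed) children of type $A$ at jump $i$ for $1<i<k$, and $a_k$ (signed) children of type $A$ at jump $k$; a node of type $A$ has $a_j$ (signed) children of type $A$ at jump $j$ for each $1\le j\le k$. Then the signed level counts $F_n$ of this rule satisfy $F_n=f_n$ for all $n\ge0$.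
   Context: An extended succession rule (with jumps and marked labels) is given by a set of label types, a root type, and for each label type $t$, each jump $j\ge1$ and each label type $t'$ an integer multiplicity $m_j(t,t')$ (finitely many nonzero). Its generating tree: the root has the root type, weight $+1$, level $0$; a node of type $t$ and weight $\varepsilon\in\{\pm1\}$ at level $n$ has, for each $j,t'$ with $m_j(t,t')\ne0$, exactly $|m_j(t,t')|$ children of type $t'$ at level $n+j$, each of weight $\varepsilon\cdot\mathrm{sign}(m_j(t,t'))$. The notation $(t)^m$ with $m<0$ denotes $|m|$ marked copies (weight $-1$). Distinct label types are kept distinct even if their numerical values coincide. The signed level count $F_n$ is the sum of the weights of all nodes at level $n$. -}

module Defs where

open import Data.Nat as ℕ using (ℕ; zero; suc; _<ᵇ_; _≡ᵇ_)
open import Data.Integer as ℤ using (ℤ; +_; _-_; ∣_∣; sign)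
open import Data.Sign as Sign using (Sign)
open import Data.Bool using (if_then_else_; _∧_)
open import Data.List as List using (List; []; _∷_; concatMap; replicate; map; upTo; zip; reverse)
open import Data.Vec as Vec using (Vec; []; _∷_; toList)
open import Data.Product using (_×_; _,_; proj₁; proj₂)

record Rule : Set₁ where
  field
    Type  : Set
    types : List Type
    root  : Type
    mult  : ℕ → Type → Type → ℤ      -- mult j t t' = m_j(t,t')  (only j ≥ 1 is used)

-- a node of the generating tree: its label type and its weight (sign ±1)
Node : Rule → Set
Node R = Rule.Type R × Sign

childrenAt : (R : Rule) → ℕ → Node R → List (Node R)
childrenAt R j (t , ε) =
  concatMap (λ t' → let m = Rule.mult R j t t' in
                    replicate ∣ m ∣ (t' , ε Sign.* sign m))
            (Rule.types R)

-- levels R n = (nodes at level n) ∷ (nodes at level n-1) ∷ … ∷ (nodes at level 0)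
-- A node at level n+1 is a child at jump i+1 of a node at level n-i.
levels : (R : Rule) → (n : ℕ) → Vec (List (Node R)) (suc n)
levels R zero    = ((Rule.root R , Sign.+) ∷ []) ∷ []
levels R (suc n) = new ∷ prev
  where
  prev = levels R n
  new  = concatMap (λ { (i , lvl) → concatMap (childrenAt R (suc i)) lvl })
                   (zip (upTo (suc n)) (toList prev))

nodesAt : (R : Rule) → ℕ → List (Node R)
nodesAt R n = Vec.head (levels R n)

weight : {R : Rule} → Node R → ℤ
weight (_ , Sign.+) = ℤ.+ 1
weight (_ , Sign.-) = ℤ.- (ℤ.+ 1)

F : Rule → ℕ → ℤ
F R n = List.foldr ℤ._+_ (ℤ.+ 0) (map (weight {R}) (nodesAt R n))

-- Σ_{j=lo}^{hi} g j   (empty if hi < lo)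
sumFromTo : ℕ → ℕ → (ℕ → ℤ) → ℤ
sumFromTo lo hi g = List.foldr ℤ._+_ (ℤ.+ 0) (map g (List.applyUpTo (λ i → lo ℕ.+ i) (suc hi ℕ.∸ lo)))

-- safe indexing of a list with default 0 (never hits the default below)
at : List ℤ → ℕ → ℤ
at []       _       = ℤ.+ 0
at (x ∷ xs) zero    = x
at (x ∷ xs) (suc i) = at xs i

-- The linear recurrence: f_0 = 1, f_i = h_i (1 ≤ i < k),
-- f_n = a_1 f_{n-1} + … + a_k f_{n-k}  (n ≥ k).
-- a j stands for a_j (1 ≤ j ≤ k), h i for h_i (1 ≤ i < k); other values are unused.

-- fList k a h n = f_n ∷ f_{n-1} ∷ … ∷ f_0
fList : (k : ℕ) → (a h : ℕ → ℤ) → ℕ → List ℤ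
fList k a h zero    = ℤ.+ 1 ∷ []
fList k a h (suc n) =
  (if suc n <ᵇ k then h (suc n)
   else sumFromTo 1 k (λ j → a j ℤ.* at prev (j ℕ.∸ 1))) ∷ prev
  where prev = fList k a h n

f : (k : ℕ) → (a h : ℕ → ℤ) → ℕ → ℤ
f k a h n = at (fList k a h n) 0

data Label : Set where
  A B : Label          -- B has value h_1 (root), A has value a_1

multP : (k : ℕ) → (a h : ℕ → ℤ) → ℕ → Label → Label → ℤ
multP k a h j B A =
  if j ≡ᵇ 1 then h 1
  else if (1 <ᵇ j) ∧ (j <ᵇ k) then h j - sumFromTo 1 (j ℕ.∸ 1) (λ i → h i ℤ.* a (j ℕ.∸ i))
  else if j ≡ᵇ k then a k
  else ℤ.+ 0
multP k a h j A A =
  if (1 <ᵇ suc j) ∧ (j <ᵇ suc k) then a j else ℤ.+ 0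
multP k a h j _ B = ℤ.+ 0

ruleP : (k : ℕ) → (a h : ℕ → ℤ) → Rule
ruleP k a h = record
  { Type  = Label
  ; types = A ∷ B ∷ []
  ; root  = B
  ; mult  = multP k a h
  }

-- Only the root is a B-node; every other node has type A.  If α n is the signed number of
-- A-nodes at level n, then α 0 = 0 and the productions give
--   α (n+1) = a'₁ α n + … + a'ₙ α 1 + b (n+1),
-- where a'ⱼ is a_j for j ≤ k and 0 for j > k, and b j is the multiplicity of the root's
-- children at jump j.  The sequence f obeys the same recurrence: for n+1 < k the correction
-- b (n+1) = h_{n+1} − Σ_{j≤n} h_j a_{n+1−j} is exactly what the convolution misses, and for
-- n+1 ≥ k, b (n+1) = a'_{n+1} = a'_{n+1} f₀ is the missing term involving f₀.  A recurrence
-- expressing u (n+1) through u 1, …, u n alone has at most one solution from index 1 on, so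
-- F_n = α n = f_n for n ≥ 1, while F₀ = f₀ = 1.
module Submission where

open import Defs
open import Data.Nat using (ℕ; _≤_)
open import Data.Integer using (ℤ)
open import Relation.Binary.PropositionalEquality using (_≡_)

open import Data.Nat as ℕ using (zero; suc; _<_; _∸_; z<s; s≤s; _<ᵇ_; _≡ᵇ_)
import Data.Nat.Properties as ℕₚ
open import Data.Nat.Induction using (<-rec)
open import Data.Integer as ℤ using (+_; -[1+_]; _+_; _*_; _-_)
import Data.Integer.Properties as ℤₚ
open import Data.Integer.Tactic.RingSolver using (solve-∀)
import Data.Sign as Sign
open import Data.Bool using (true; false; if_then_else_; T)
open import Data.List as List using (List; []; _∷_; _++_)
import Data.Vec as Vec
open import Data.Product using (_×_; _,_)
open import Data.Sum using (inj₁; inj₂)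
open import Relation.Nullary using (¬_; contradiction; yes; no)
open import Relation.Binary.PropositionalEquality using (refl; sym; trans; cong; cong₂; module ≡-Reasoning)
open ≡-Reasoning

if-T : ∀ {ℓ} {A : Set ℓ} {b} {x y : A} → T b → (if b then x else y) ≡ x
if-T {b = true} _ = refl

if-¬T : ∀ {ℓ} {A : Set ℓ} {b} {x y : A} → ¬ T b → (if b then x else y) ≡ y
if-¬T {b = true}  ¬t = contradiction _ ¬t
if-¬T {b = false} _  = refl

∸-suc : ∀ {n i} → i < n → n ∸ i ≡ suc (n ∸ suc i)
∸-suc {suc n} (s≤s i≤n) = ℕₚ.+-∸-assoc 1 i≤n

∑ : ℕ → (ℕ → ℤ) → ℤ
∑ zero    g = + 0
∑ (suc n) g = g 0 + ∑ n (λ i → g (suc i))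

∑-cong : ∀ n {g g′ : ℕ → ℤ} → (∀ i → i < n → g i ≡ g′ i) → ∑ n g ≡ ∑ n g′
∑-cong zero    eq = refl
∑-cong (suc n) eq = cong₂ _+_ (eq 0 z<s) (∑-cong n (λ i i<n → eq (suc i) (s≤s i<n)))

∑-zero : ∀ n {g : ℕ → ℤ} → (∀ i → i < n → g i ≡ + 0) → ∑ n g ≡ + 0
∑-zero zero    eq = refl
∑-zero (suc n) eq = cong₂ _+_ (eq 0 z<s) (∑-zero n (λ i i<n → eq (suc i) (s≤s i<n)))

∑-distrib-+ : ∀ n (g g′ : ℕ → ℤ) → ∑ n (λ i → g i + g′ i) ≡ ∑ n g + ∑ n g′
∑-distrib-+ zero    g g′ = refl
∑-distrib-+ (suc n) g g′ = begin
  (g 0 + g′ 0) + ∑ n (λ i → g (suc i) + g′ (suc i))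
    ≡⟨ cong (_+_ (g 0 + g′ 0)) (∑-distrib-+ n (λ i → g (suc i)) (λ i → g′ (suc i))) ⟩
  (g 0 + g′ 0) + (∑ n (λ i → g (suc i)) + ∑ n (λ i → g′ (suc i)))
    ≡⟨ interchange (g 0) (g′ 0) _ _ ⟩
  (g 0 + ∑ n (λ i → g (suc i))) + (g′ 0 + ∑ n (λ i → g′ (suc i))) ∎
  where
  interchange : ∀ p q r s → (p + q) + (r + s) ≡ (p + r) + (q + s)
  interchange = solve-∀

∑-snoc : ∀ n (g : ℕ → ℤ) → ∑ (suc n) g ≡ ∑ n g + g n
∑-snoc zero    g = ℤₚ.+-comm (g 0) (+ 0)
∑-snoc (suc n) g =
  trans (cong (_+_ (g 0)) (∑-snoc n (λ i → g (suc i)))) (sym (ℤₚ.+-assoc (g 0) _ _))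

∑-split : ∀ m r (g : ℕ → ℤ) → ∑ (m ℕ.+ r) g ≡ ∑ m g + ∑ r (λ i → g (m ℕ.+ i))
∑-split zero    r g = sym (ℤₚ.+-identityˡ _)
∑-split (suc m) r g =
  trans (cong (_+_ (g 0)) (∑-split m r (λ i → g (suc i)))) (sym (ℤₚ.+-assoc (g 0) _ _))

∑-reverse : ∀ n (g : ℕ → ℤ) → ∑ n g ≡ ∑ n (λ i → g (n ∸ suc i))
∑-reverse zero    g = refl
∑-reverse (suc n) g = begin
  g 0 + ∑ n (λ i → g (suc i))              ≡⟨ cong (_+_ (g 0)) (∑-reverse n (λ i → g (suc i))) ⟩
  g 0 + ∑ n (λ i → g (suc (n ∸ suc i)))    ≡⟨ ℤₚ.+-comm (g 0) _ ⟩
  ∑ n (λ i → g (suc (n ∸ suc i))) + g 0    ≡⟨ cong₂ _+_ (∑-cong n (λ i i<n → cong g (sym (∸-suc i<n))))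
                                                        (cong g (sym (ℕₚ.n∸n≡0 n))) ⟩
  ∑ n (λ i → g (n ∸ i)) + g (n ∸ n)        ≡⟨ sym (∑-snoc n (λ i → g (n ∸ i))) ⟩
  ∑ (suc n) (λ i → g (n ∸ i))              ∎

sumFromTo≡∑ : ∀ lo hi g → sumFromTo lo hi g ≡ ∑ (suc hi ∸ lo) (λ i → g (lo ℕ.+ i))
sumFromTo≡∑ lo hi g = foldr-map-applyUpTo (suc hi ∸ lo) (lo ℕ.+_)
  where
  foldr-map-applyUpTo : ∀ m (e : ℕ → ℕ) →
    List.foldr _+_ (+ 0) (List.map g (List.applyUpTo e m)) ≡ ∑ m (λ i → g (e i))
  foldr-map-applyUpTo zero    e = refl
  foldr-map-applyUpTo (suc m) e = cong (_+_ (g (e 0))) (foldr-map-applyUpTo m (λ i → e (suc i)))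

strictRecurrence-unique : (c d u v : ℕ → ℤ) →
  (∀ n → u (suc n) ≡ ∑ n (λ i → c i * u (n ∸ i)) + d n) →
  (∀ n → v (suc n) ≡ ∑ n (λ i → c i * v (n ∸ i)) + d n) →
  ∀ n → u (suc n) ≡ v (suc n)
strictRecurrence-unique c d u v u-rec v-rec = <-rec (λ n → u (suc n) ≡ v (suc n)) step
  where
  step : ∀ n → (∀ {m} → m < n → u (suc m) ≡ v (suc m)) → u (suc n) ≡ v (suc n)
  step n IH = begin
    u (suc n)                             ≡⟨ u-rec n ⟩
    ∑ n (λ i → c i * u (n ∸ i)) + d n     ≡⟨ cong (_+ d n) (∑-cong n (λ i i<n → cong (c i *_) (agree i<n))) ⟩
    ∑ n (λ i → c i * v (n ∸ i)) + d n     ≡⟨ sym (v-rec n) ⟩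
    v (suc n)                             ∎
    where
    agree : ∀ {i} → i < n → u (n ∸ i) ≡ v (n ∸ i)
    agree {i} i<n rewrite ∸-suc i<n = IH (ℕₚ.∸-monoʳ-< z<s i<n)

module SignedCount (R : Rule) where
  open Rule R

  count : (Type → ℤ) → List (Node R) → ℤ
  count w []             = + 0
  count w ((t , ε) ∷ xs) = weight {R} (t , ε) * w t + count w xs

  transfer : ℕ → (Type → ℤ) → Type → ℤ
  transfer j w t = List.foldr _+_ (+ 0) (List.map (λ t′ → mult j t t′ * w t′) types)

  F≡count : ∀ n → F R n ≡ count (λ _ → + 1) (nodesAt R n)
  F≡count n = go (nodesAt R n)
    where
    go : ∀ xs → List.foldr _+_ (+ 0) (List.map (weight {R}) xs) ≡ count (λ _ → + 1) xs
    go []       = refl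
    go (x ∷ xs) = cong₂ _+_ (sym (ℤₚ.*-identityʳ (weight {R} x))) (go xs)

  count-++ : ∀ w xs ys → count w (xs ++ ys) ≡ count w xs + count w ys
  count-++ w []             ys = sym (ℤₚ.+-identityˡ _)
  count-++ w ((t , ε) ∷ xs) ys =
    trans (cong (_+_ (weight {R} (t , ε) * w t)) (count-++ w xs ys))
          (sym (ℤₚ.+-assoc (weight {R} (t , ε) * w t) (count w xs) (count w ys)))

  count-replicate : ∀ w m (x : Node R) → count w (List.replicate m x) ≡ + m * count w (x ∷ [])
  count-replicate w zero    x = refl
  count-replicate w (suc m) (t , ε) = begin
    s + count w (List.replicate m (t , ε))   ≡⟨ cong (_+_ s) (count-replicate w m (t , ε)) ⟩
    s + + m * (s + + 0)                      ≡⟨ lemma s (+ m) ⟩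
    + suc m * (s + + 0)                      ∎
    where
    s = weight {R} (t , ε) * w t
    lemma : ∀ s m → s + m * (s + + 0) ≡ (+ 1 + m) * (s + + 0)
    lemma = solve-∀

  ∣m∣*weight : ∀ (t t′ : Type) ε m → + ℤ.∣ m ∣ * weight {R} (t′ , ε Sign.* ℤ.sign m) ≡ weight {R} (t , ε) * m
  ∣m∣*weight t t′ Sign.+ (+ zero)    = refl
  ∣m∣*weight t t′ Sign.- (+ zero)    = refl
  ∣m∣*weight t t′ Sign.+ (+ (suc n)) = trans (ℤₚ.*-identityʳ (+ suc n)) (sym (ℤₚ.*-identityˡ (+ suc n)))
  ∣m∣*weight t t′ Sign.- (+ (suc n)) = ℤₚ.*-comm (+ suc n) _
  ∣m∣*weight t t′ Sign.+ -[1+ n ]    = ℤₚ.*-comm (+ suc n) _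
  ∣m∣*weight t t′ Sign.- -[1+ n ]    = trans (ℤₚ.*-identityʳ (+ suc n)) (sym (ℤₚ.-1*i≡-i -[1+ n ]))

  count-childrenAt : ∀ w j t ε → count w (childrenAt R j (t , ε)) ≡ weight {R} (t , ε) * transfer j w t
  count-childrenAt w j t ε = go types
    where
    go : ∀ ts →
      count w (List.concatMap (λ t′ → List.replicate ℤ.∣ mult j t t′ ∣ (t′ , ε Sign.* ℤ.sign (mult j t t′))) ts)
      ≡ weight {R} (t , ε) * List.foldr _+_ (+ 0) (List.map (λ t′ → mult j t t′ * w t′) ts)
    go []        = sym (ℤₚ.*-zeroʳ (weight {R} (t , ε)))
    go (t′ ∷ ts) = begin
      count w (List.replicate ∣m∣ (t′ , ε′) ++ _)         ≡⟨ count-++ w (List.replicate ∣m∣ (t′ , ε′)) _ ⟩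
      count w (List.replicate ∣m∣ (t′ , ε′)) + _          ≡⟨ cong₂ _+_ (count-replicate w ∣m∣ (t′ , ε′)) (go ts) ⟩
      + ∣m∣ * (weight {R} (t′ , ε′) * w t′ + + 0) + e * _  ≡⟨ cong (λ z → + ∣m∣ * z + e * _) (ℤₚ.+-identityʳ _) ⟩
      + ∣m∣ * (weight {R} (t′ , ε′) * w t′) + e * _       ≡⟨ cong (_+ e * _) (sym (ℤₚ.*-assoc (+ ∣m∣) _ (w t′))) ⟩
      + ∣m∣ * weight {R} (t′ , ε′) * w t′ + e * _         ≡⟨ cong (λ z → z * w t′ + e * _) (∣m∣*weight t t′ ε m) ⟩
      e * m * w t′ + e * _                                ≡⟨ cong (_+ e * _) (ℤₚ.*-assoc e m (w t′)) ⟩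
      e * (m * w t′) + e * _                              ≡⟨ sym (ℤₚ.*-distribˡ-+ e _ _) ⟩
      e * (m * w t′ + _)                                  ∎
      where
      m = mult j t t′
      ∣m∣ = ℤ.∣ m ∣
      ε′ = ε Sign.* ℤ.sign m
      e = weight {R} (t , ε)

  count-children : ∀ w j xs → count w (List.concatMap (childrenAt R j) xs) ≡ count (transfer j w) xs
  count-children w j []             = refl
  count-children w j ((t , ε) ∷ xs) = begin
    count w (childrenAt R j (t , ε) ++ List.concatMap (childrenAt R j) xs)
      ≡⟨ count-++ w (childrenAt R j (t , ε)) _ ⟩
    count w (childrenAt R j (t , ε)) + count w (List.concatMap (childrenAt R j) xs)
      ≡⟨ cong₂ _+_ (count-childrenAt w j t ε) (count-children w j xs) ⟩
    weight {R} (t , ε) * transfer j w t + count (transfer j w) xs ∎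

  count-nodesAt-suc : ∀ w n →
    count w (nodesAt R (suc n)) ≡ ∑ (suc n) (λ i → count (transfer (suc i) w) (nodesAt R (n ∸ i)))
  count-nodesAt-suc w n = go _ (λ i → count-children w (suc i)) n (λ i → i)
    where
    -- φ abstracts the pattern-matching lambda in the definition of levels.
    go : (φ : ℕ × List (Node R) → List (Node R)) →
         (∀ i xs → count w (φ (i , xs)) ≡ count (transfer (suc i) w) xs) →
         ∀ n (e : ℕ → ℕ) →
         count w (List.concatMap φ (List.zip (List.applyUpTo e (suc n)) (Vec.toList (levels R n))))
         ≡ ∑ (suc n) (λ i → count (transfer (suc (e i)) w) (nodesAt R (n ∸ i)))
    go φ φ-count zero    e = trans (count-++ w (φ (e 0 , nodesAt R 0)) [])
                                   (cong (λ z → z + + 0) (φ-count (e 0) (nodesAt R 0)))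
    go φ φ-count (suc n) e = trans (count-++ w (φ (e 0 , nodesAt R (suc n))) _)
                                   (cong₂ _+_ (φ-count (e 0) _) (go φ φ-count n (λ i → e (suc i))))

module Proposition5 (k : ℕ) (a h : ℕ → ℤ) where
  R : Rule
  R = ruleP k a h
  open SignedCount R

  mA mB : ℕ → ℤ
  mA j = multP k a h j A A
  mB j = multP k a h j B A

  isA isB : Label → ℤ
  isA A = + 1
  isA B = + 0
  isB A = + 0
  isB B = + 1

  α β : ℕ → ℤ
  α n = count isA (nodesAt R n)
  β n = count isB (nodesAt R n)

  count-byLabel : ∀ w xs → count w xs ≡ w A * count isA xs + w B * count isB xs
  count-byLabel w []             = sym (cong₂ _+_ (ℤₚ.*-zeroʳ (w A)) (ℤₚ.*-zeroʳ (w B)))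
  count-byLabel w ((A , ε) ∷ xs) =
    trans (cong (_+_ (weight {R} (A , ε) * w A)) (count-byLabel w xs)) (regroupA (weight {R} (A , ε)) (w A) (w B) _ _)
    where
    regroupA : ∀ s x y p q → s * x + (x * p + y * q) ≡ x * (s * + 1 + p) + y * (s * + 0 + q)
    regroupA = solve-∀
  count-byLabel w ((B , ε) ∷ xs) =
    trans (cong (_+_ (weight {R} (B , ε) * w B)) (count-byLabel w xs)) (regroupB (weight {R} (B , ε)) (w A) (w B) _ _)
    where
    regroupB : ∀ s x y p q → s * y + (x * p + y * q) ≡ x * (s * + 0 + p) + y * (s * + 1 + q)
    regroupB = solve-∀

  -- No production creates a B-node, so only the A-value of w is ever passed on.
  transfer-ruleP : ∀ j w t → transfer j w t ≡ multP k a h j t A * w A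
  transfer-ruleP j w A = ℤₚ.+-identityʳ (mA j * w A)
  transfer-ruleP j w B = ℤₚ.+-identityʳ (mB j * w A)

  count-transfer : ∀ j w xs → count (transfer j w) xs ≡ w A * (mA j * count isA xs + mB j * count isB xs)
  count-transfer j w xs = begin
    count (transfer j w) xs
      ≡⟨ count-byLabel (transfer j w) xs ⟩
    transfer j w A * count isA xs + transfer j w B * count isB xs
      ≡⟨ cong₂ (λ x y → x * count isA xs + y * count isB xs) (transfer-ruleP j w A) (transfer-ruleP j w B) ⟩
    mA j * w A * count isA xs + mB j * w A * count isB xs
      ≡⟨ factor (mA j) (mB j) (w A) _ _ ⟩
    w A * (mA j * count isA xs + mB j * count isB xs) ∎
    where
    factor : ∀ p q x u v → p * x * u + q * x * v ≡ x * (p * u + q * v)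
    factor = solve-∀

  F≡α+β : ∀ n → F R n ≡ α n + β n
  F≡α+β n = trans (F≡count n)
    (trans (count-byLabel (λ _ → + 1) (nodesAt R n)) (cong₂ _+_ (ℤₚ.*-identityˡ (α n)) (ℤₚ.*-identityˡ (β n))))

  β-suc : ∀ n → β (suc n) ≡ + 0
  β-suc n = trans (count-nodesAt-suc isB n) (∑-zero (suc n) (λ i _ → count-transfer (suc i) isB (nodesAt R (n ∸ i))))

  ∑-β : ∀ n (g : ℕ → ℤ) → ∑ (suc n) (λ i → g i * β (n ∸ i)) ≡ g n
  ∑-β zero    g = trans (ℤₚ.+-identityʳ (g 0 * + 1)) (ℤₚ.*-identityʳ (g 0))
  ∑-β (suc n) g = begin
    g 0 * β (suc n) + rest ≡⟨ cong (λ z → g 0 * z + rest) (β-suc n) ⟩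
    g 0 * + 0 + rest       ≡⟨ cong (_+ rest) (ℤₚ.*-zeroʳ (g 0)) ⟩
    + 0 + rest             ≡⟨ ℤₚ.+-identityˡ rest ⟩
    rest                   ≡⟨ ∑-β n (λ i → g (suc i)) ⟩
    g (suc n)              ∎
    where
    rest = ∑ (suc n) (λ i → g (suc i) * β (n ∸ i))

  α-recurrence : ∀ n → α (suc n) ≡ ∑ n (λ i → mA (suc i) * α (n ∸ i)) + mB (suc n)
  α-recurrence n = begin
    α (suc n)
      ≡⟨ count-nodesAt-suc isA n ⟩
    ∑ (suc n) (λ i → count (transfer (suc i) isA) (nodesAt R (n ∸ i)))
      ≡⟨ ∑-cong (suc n) (λ i _ → trans (count-transfer (suc i) isA (nodesAt R (n ∸ i))) (ℤₚ.*-identityˡ _)) ⟩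
    ∑ (suc n) (λ i → G i + mB (suc i) * β (n ∸ i))
      ≡⟨ ∑-distrib-+ (suc n) G (λ i → mB (suc i) * β (n ∸ i)) ⟩
    ∑ (suc n) G + ∑ (suc n) (λ i → mB (suc i) * β (n ∸ i))
      ≡⟨ cong₂ _+_ (∑-snoc n G) (∑-β n (λ i → mB (suc i))) ⟩
    ∑ n G + mA (suc n) * α (n ∸ n) + mB (suc n)
      ≡⟨ cong (λ z → ∑ n G + mA (suc n) * α z + mB (suc n)) (ℕₚ.n∸n≡0 n) ⟩
    ∑ n G + mA (suc n) * + 0 + mB (suc n)
      ≡⟨ cong (λ z → ∑ n G + z + mB (suc n)) (ℤₚ.*-zeroʳ (mA (suc n))) ⟩
    ∑ n G + + 0 + mB (suc n)
      ≡⟨ cong (_+ mB (suc n)) (ℤₚ.+-identityʳ (∑ n G)) ⟩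
    ∑ n G + mB (suc n) ∎
    where
    G : ℕ → ℤ
    G i = mA (suc i) * α (n ∸ i)

  mA-below : ∀ j → j < k → mA (suc j) ≡ a (suc j)
  mA-below j j<k = if-T (ℕₚ.<⇒<ᵇ j<k)

  mA-above : ∀ j → k ≤ j → mA (suc j) ≡ + 0
  mA-above j k≤j = if-¬T (λ t → ℕₚ.≤⇒≯ k≤j (ℕₚ.<ᵇ⇒< j k t))

  mB-below : ∀ n → suc n < k → mB (suc n) ≡ h (suc n) - ∑ n (λ i → h (suc i) * a (n ∸ i))
  mB-below zero    _   = sym (ℤₚ.+-identityʳ (h 1))
  mB-below (suc n) n<k = trans (if-T (ℕₚ.<⇒<ᵇ n<k))
    (cong (_-_ (h (suc (suc n)))) (sumFromTo≡∑ 1 (suc n) (λ i → h i * a (suc (suc n) ∸ i))))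

  mB-above : ∀ j → 2 ≤ k → k ≤ j → mB j ≡ mA j
  mB-above zero          2≤k k≤j = contradiction (ℕₚ.≤-trans 2≤k k≤j) λ ()
  mB-above (suc zero)    2≤k k≤j = contradiction (ℕₚ.≤-trans 2≤k k≤j) λ { (s≤s ()) }
  mB-above j@(suc (suc _)) 2≤k k≤j with ℕₚ.m≤n⇒m<n∨m≡n k≤j
  ... | inj₁ k<j = begin
    mB j ≡⟨ if-¬T j≮k ⟩
    (if j ≡ᵇ k then a k else + 0) ≡⟨ if-¬T (λ t → ℕₚ.<-irrefl (sym (ℕₚ.≡ᵇ⇒≡ j k t)) k<j) ⟩
    + 0 ≡⟨ sym (if-¬T (λ t → ℕₚ.≤⇒≯ (ℕₚ.≤-pred (ℕₚ.<ᵇ⇒< j (suc k) t)) k<j)) ⟩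
    mA j ∎
    where
    j≮k : ¬ T (j <ᵇ k)
    j≮k t = ℕₚ.≤⇒≯ k≤j (ℕₚ.<ᵇ⇒< j k t)
  ... | inj₂ k≡j = begin
    mB j ≡⟨ if-¬T (λ t → ℕₚ.≤⇒≯ k≤j (ℕₚ.<ᵇ⇒< j k t)) ⟩
    (if j ≡ᵇ k then a k else + 0) ≡⟨ if-T (ℕₚ.≡⇒≡ᵇ j k (sym k≡j)) ⟩
    a k ≡⟨ cong a k≡j ⟩
    a j ≡⟨ sym (if-T (ℕₚ.<⇒<ᵇ (s≤s (ℕₚ.≤-reflexive (sym k≡j))))) ⟩
    mA j ∎

  f-at : ∀ n i → i ≤ n → at (fList k a h n) i ≡ f k a h (n ∸ i)
  f-at n       zero    _         = refl
  f-at (suc n) (suc i) (s≤s i≤n) = f-at n i i≤n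

  f-below : ∀ n → suc n < k → f k a h (suc n) ≡ h (suc n)
  f-below n n<k = if-T (ℕₚ.<⇒<ᵇ n<k)

  f-above : ∀ n → k ≤ suc n → f k a h (suc n) ≡ ∑ k (λ j → a (suc j) * f k a h (n ∸ j))
  f-above n k≤n = begin
    f k a h (suc n)
      ≡⟨ if-¬T (λ t → ℕₚ.≤⇒≯ k≤n (ℕₚ.<ᵇ⇒< (suc n) k t)) ⟩
    sumFromTo 1 k (λ j → a j * at (fList k a h n) (j ∸ 1))
      ≡⟨ sumFromTo≡∑ 1 k (λ j → a j * at (fList k a h n) (j ∸ 1)) ⟩
    ∑ k (λ j → a (suc j) * at (fList k a h n) j)
      ≡⟨ ∑-cong k (λ j j<k → cong (a (suc j) *_) (f-at n j (ℕₚ.≤-pred (ℕₚ.≤-trans j<k k≤n)))) ⟩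
    ∑ k (λ j → a (suc j) * f k a h (n ∸ j)) ∎

  f-recurrence-below : ∀ n → suc n < k → f k a h (suc n) ≡ ∑ n (λ i → mA (suc i) * f k a h (n ∸ i)) + mB (suc n)
  f-recurrence-below n n<k = begin
    f k a h (suc n)                                      ≡⟨ f-below n n<k ⟩
    h (suc n)                                            ≡⟨ cancel (h (suc n)) S ⟩
    S + (h (suc n) - S)                                  ≡⟨ cong₂ _+_ (sym convolution) (sym (mB-below n n<k)) ⟩
    ∑ n (λ i → mA (suc i) * f k a h (n ∸ i)) + mB (suc n) ∎
    where
    S = ∑ n (λ i → h (suc i) * a (n ∸ i))
    cancel : ∀ x s → x ≡ s + (x - s)
    cancel = solve-∀
    f≡h : ∀ {i} → i < n → f k a h (n ∸ i) ≡ h (n ∸ i)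
    f≡h {i} i<n rewrite ∸-suc i<n = f-below (n ∸ suc i) (ℕₚ.≤-trans (s≤s (s≤s (ℕₚ.m∸n≤m n (suc i)))) n<k)
    convolution : ∑ n (λ i → mA (suc i) * f k a h (n ∸ i)) ≡ S
    convolution = begin
      ∑ n (λ i → mA (suc i) * f k a h (n ∸ i))
        ≡⟨ ∑-cong n (λ i i<n → cong₂ _*_ (mA-below i (ℕₚ.<-trans i<n (ℕₚ.<-trans (ℕₚ.n<1+n n) n<k))) (f≡h i<n)) ⟩
      ∑ n (λ i → a (suc i) * h (n ∸ i))
        ≡⟨ ∑-reverse n (λ i → a (suc i) * h (n ∸ i)) ⟩
      ∑ n (λ i → a (suc (n ∸ suc i)) * h (n ∸ (n ∸ suc i)))
        ≡⟨ ∑-cong n (λ i i<n → trans (cong₂ _*_ (cong a (sym (∸-suc i<n))) (cong h (ℕₚ.m∸[m∸n]≡n i<n)))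
                                       (ℤₚ.*-comm (a (n ∸ i)) (h (suc i)))) ⟩
      S ∎

  f-recurrence-above : 2 ≤ k → ∀ n → k ≤ suc n → f k a h (suc n) ≡ ∑ n (λ i → mA (suc i) * f k a h (n ∸ i)) + mB (suc n)
  f-recurrence-above 2≤k n k≤n = begin
    f k a h (suc n)                          ≡⟨ f-above n k≤n ⟩
    ∑ k (λ j → a (suc j) * f k a h (n ∸ j))  ≡⟨ sym truncate ⟩
    ∑ (suc n) H                              ≡⟨ ∑-snoc n H ⟩
    ∑ n H + mA (suc n) * f k a h (n ∸ n)     ≡⟨ cong (λ z → ∑ n H + mA (suc n) * f k a h z) (ℕₚ.n∸n≡0 n) ⟩
    ∑ n H + mA (suc n) * + 1                 ≡⟨ cong (_+_ (∑ n H)) (ℤₚ.*-identityʳ (mA (suc n))) ⟩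
    ∑ n H + mA (suc n)                       ≡⟨ cong (_+_ (∑ n H)) (sym (mB-above (suc n) 2≤k k≤n)) ⟩
    ∑ n H + mB (suc n)                       ∎
    where
    H : ℕ → ℤ
    H i = mA (suc i) * f k a h (n ∸ i)
    truncate : ∑ (suc n) H ≡ ∑ k (λ j → a (suc j) * f k a h (n ∸ j))
    truncate = begin
      ∑ (suc n) H
        ≡⟨ cong (λ m → ∑ m H) (sym (ℕₚ.m+[n∸m]≡n k≤n)) ⟩
      ∑ (k ℕ.+ (suc n ∸ k)) H
        ≡⟨ ∑-split k (suc n ∸ k) H ⟩
      ∑ k H + ∑ (suc n ∸ k) (λ i → H (k ℕ.+ i))
        ≡⟨ cong₂ _+_ (∑-cong k (λ j j<k → cong (_* f k a h (n ∸ j)) (mA-below j j<k)))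
                     (∑-zero (suc n ∸ k) (λ i _ → cong (_* f k a h (n ∸ (k ℕ.+ i))) (mA-above (k ℕ.+ i) (ℕₚ.m≤m+n k i)))) ⟩
      ∑ k (λ j → a (suc j) * f k a h (n ∸ j)) + + 0
        ≡⟨ ℤₚ.+-identityʳ _ ⟩
      ∑ k (λ j → a (suc j) * f k a h (n ∸ j)) ∎

  f-recurrence : 2 ≤ k → ∀ n → f k a h (suc n) ≡ ∑ n (λ i → mA (suc i) * f k a h (n ∸ i)) + mB (suc n)
  f-recurrence 2≤k n with suc n ℕ.<? k
  ... | yes n<k = f-recurrence-below n n<k
  ... | no  n≮k = f-recurrence-above 2≤k n (ℕₚ.≮⇒≥ n≮k)

proposition5 : (k : ℕ) → 2 ≤ k → (a h : ℕ → ℤ) →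
    (n : ℕ) → F (ruleP k a h) n ≡ f k a h n
proposition5 k 2≤k a h zero    = refl
proposition5 k 2≤k a h (suc n) = begin
  F R (suc n)             ≡⟨ F≡α+β (suc n) ⟩
  α (suc n) + β (suc n)   ≡⟨ cong (_+_ (α (suc n))) (β-suc n) ⟩
  α (suc n) + + 0         ≡⟨ ℤₚ.+-identityʳ (α (suc n)) ⟩
  α (suc n)               ≡⟨ strictRecurrence-unique (λ i → mA (suc i)) (λ n → mB (suc n)) α (f k a h)
                               α-recurrence (f-recurrence 2≤k) n ⟩
  f k a h (suc n)         ∎
  where open Proposition5 k a h
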